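{- Let $f,g$ be two covers with $f\sqsubseteq g$. If $g$ is a minimal cover with respect to the property $|{\rm Hom}(g,f)|=\deg f$, then $g$ is a Galois closure of $f$.
   Context: Let $\mathbf C$ be a category and $\mathbf D$ a full subcategory of $\mathbf C$. For arrows $f,g$ of $\mathbf C$ with ${\rm cod}\,f={\rm cod}\,g$, ${\rm Hom}(g,f)$ denotes the collection of all arrows $h$ of $\mathbf C$ with $g=f\circ h$. Standing assumptions: (G1) every diagram $B\to A\leftarrow C$ in $\mathbf D$ has a pullback in $\mathbf C$. (G2) (I) pushouts exist in $\mathbf D$; (II) every arrow of $\mathbf D$ is epic; (III) every monic arrow of $\mathbf D$ is an isomorphism whose inverse is an arrow of $\mathbf D$. (G3) for every object $U$ of $\mathbf C$ there is a set $\Sigma(U)$ of arrows $i$ of $\mathbf C$ with ${\rm dom}\,i$ in $\mathbf D$ and ${\rm cod}\,i=U$ such that for every arrow $u$ of $\mathbf C$ with ${\rm dom}\,u$ in $\mathbf D$ and ${\rm cod}\,u=U$ there is exactly one $i\in\Sigma(U)$ with ${\rm Hom}(u,i)\neq\emptyset$. (G4) there is a function $\deg$ from the collection of arrows of $\mathbf C$ whose codomain lies in $\mathbf D$ to the positive integers such that (I) $\deg(g\circ f)=\deg g\cdot\deg f$ whenever $f,g,g\circ f$ all lie in this collection; (II) $\deg f=\sum_{i\in\Sigma({\rm dom}\,f)}\deg(f\circ i)$ for every such $f$; (III) if $B\xrightarrow{f}A\xleftarrow{g}C$ is a diagram in $\mathbf D$ with pullback $B\xleftarrow{p}U\xrightarrow{q}C$,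 then $\deg f=\deg q$ and $\deg g=\deg p$. A cover is an arrow of $\mathbf D$. For a cover $f$, ${\rm Aut}(f)$ is the set of isomorphisms in ${\rm Hom}(f,f)$; $f$ is Galois if $|{\rm Aut}(f)|=\deg f$. Write $f\sqsubseteq g$ if ${\rm cod}\,f={\rm cod}\,g$ and ${\rm Hom}(g,f)\neq\emptyset$. A cover $g$ is minimal with respect to a property $P$ if $g$ has $P$ and $g\sqsubseteq h$ for every cover $h$ with $P$ and $h\sqsubseteq g$; it is least with respect to $P$ if it has $P$ and $g\sqsubseteq h$ for every cover $h$ with $P$. A Galois closure of a cover $f$ is a cover $g$ which is minimal with respect to the property "$g$ is Galois and $f\sqsubseteq g$". -}

module Defs where

open import Level using (Level; _⊔_) renaming (suc to lsuc)
open import Data.Nat using (ℕ; zero; suc; _+_; _*_; _≤_)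
open import Data.Fin using (Fin; zero; suc)
open import Data.Bool using (Bool; T)
open import Data.Product using (Σ; Σ-syntax; ∃; ∃-syntax; _×_; _,_)
open import Relation.Binary.PropositionalEquality using (_≡_)
open import Function.Bundles using (_↔_; Inverse)

∑ : (n : ℕ) → (Fin n → ℕ) → ℕ
∑ zero    a = 0
∑ (suc n) a = a zero + ∑ n (λ k → a (suc k))

HasCard : ∀ {a p} {X : Set a} → (X → Set p) → ℕ → Set (a ⊔ p)
HasCard {X = X} P n =
  Σ[ e ∈ (Fin n → X) ]
    ((∀ k → P (e k))
    × (∀ k l → e k ≡ e l → k ≡ l)
    × (∀ x → P x → ∃[ k ] (e k ≡ x)))

record Category (o ℓ : Level) : Set (lsuc (o ⊔ ℓ)) where
  infixr 9 _∘_
  field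
    Obj  : Set o
    _⇒_  : Obj → Obj → Set ℓ
    id   : ∀ {A} → A ⇒ A
    _∘_  : ∀ {A B C} → B ⇒ C → A ⇒ B → A ⇒ C
    identityˡ : ∀ {A B} (f : A ⇒ B) → id ∘ f ≡ f
    identityʳ : ∀ {A B} (f : A ⇒ B) → f ∘ id ≡ f
    assoc     : ∀ {A B C D} (f : A ⇒ B) (g : B ⇒ C) (h : C ⇒ D) →
                (h ∘ g) ∘ f ≡ h ∘ (g ∘ f)

module CatDefs {o ℓ} (𝐂 : Category o ℓ) where
  open Category 𝐂

  HomOver : ∀ {A B X} → B ⇒ X → A ⇒ X → B ⇒ A → Set ℓ
  HomOver g f h = g ≡ f ∘ h

  IsIso : ∀ {A B} → A ⇒ B → Set ℓ
  IsIso {A} {B} f = Σ[ k ∈ B ⇒ A ] (k ∘ f ≡ id × f ∘ k ≡ id)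

  IsPullback : ∀ {A B C' U} (f : B ⇒ A) (g : C' ⇒ A) (p : U ⇒ B) (q : U ⇒ C') → Set (o ⊔ ℓ)
  IsPullback {A} {B} {C'} {U} f g p q =
    (f ∘ p ≡ g ∘ q) ×
    (∀ {V} (p' : V ⇒ B) (q' : V ⇒ C') → f ∘ p' ≡ g ∘ q' →
       Σ[ u ∈ V ⇒ U ] ((p ∘ u ≡ p' × q ∘ u ≡ q') ×
         (∀ (u' : V ⇒ U) → p ∘ u' ≡ p' → q ∘ u' ≡ q' → u' ≡ u)))

-- The standing assumptions (G1)-(G4) for a full subcategory D of C,
-- D given by a (proof-irrelevant) membership predicate on objects.
record Setting (o ℓ s : Level) : Set (lsuc (o ⊔ ℓ ⊔ s)) where
  field
    𝐂   : Category o ℓ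
  open Category 𝐂
  open CatDefs 𝐂
  field
    inD : Obj → Bool
  InD : Obj → Set
  InD A = T (inD A)

  IsPushoutInD : ∀ {A B C' P} (f : A ⇒ B) (g : A ⇒ C') (i₁ : B ⇒ P) (i₂ : C' ⇒ P) → Set (o ⊔ ℓ)
  IsPushoutInD {A} {B} {C'} {P} f g i₁ i₂ =
    (i₁ ∘ f ≡ i₂ ∘ g) ×
    (∀ {Q} → InD Q → (j₁ : B ⇒ Q) (j₂ : C' ⇒ Q) → j₁ ∘ f ≡ j₂ ∘ g →
       Σ[ u ∈ P ⇒ Q ] ((u ∘ i₁ ≡ j₁ × u ∘ i₂ ≡ j₂) ×
         (∀ (u' : P ⇒ Q) → u' ∘ i₁ ≡ j₁ → u' ∘ i₂ ≡ j₂ → u' ≡ u)))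

  EpicInD : ∀ {A B} → A ⇒ B → Set (o ⊔ ℓ)
  EpicInD {A} {B} f = ∀ {Q} → InD Q → (u v : B ⇒ Q) → u ∘ f ≡ v ∘ f → u ≡ v

  MonicInD : ∀ {A B} → A ⇒ B → Set (o ⊔ ℓ)
  MonicInD {A} {B} f = ∀ {Q} → InD Q → (u v : Q ⇒ A) → f ∘ u ≡ f ∘ v → u ≡ v

  field
    G1 : ∀ {A B C'} → InD A → InD B → InD C' → (f : B ⇒ A) (g : C' ⇒ A) →
         Σ[ U ∈ Obj ] Σ[ p ∈ U ⇒ B ] Σ[ q ∈ U ⇒ C' ] IsPullback f g p q
    G2-I : ∀ {A B C'} → InD A → InD B → InD C' → (f : A ⇒ B) (g : A ⇒ C') →
           Σ[ P ∈ Obj ] (InD P × Σ[ i₁ ∈ B ⇒ P ] Σ[ i₂ ∈ C' ⇒ P ] IsPushoutInD f g i₁ i₂)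
    G2-II : ∀ {A B} → InD A → InD B → (f : A ⇒ B) → EpicInD f
    -- (G2)(III)  (the inverse, between objects of D, is automatically in D by fullness)
    G2-III : ∀ {A B} → InD A → InD B → (f : A ⇒ B) → MonicInD f → IsIso f
    -- (G3): Σ(U) as a family indexed by Sig U
    Sig    : Obj → Set s
    sigDom : ∀ {U} → Sig U → Obj
    sigInD : ∀ {U} (i : Sig U) → InD (sigDom i)
    sig    : ∀ {U} (i : Sig U) → sigDom i ⇒ U
    G3 : ∀ {U A} → InD A → (u : A ⇒ U) →
         Σ[ i ∈ Sig U ] ((∃[ h ] HomOver u (sig i) h) ×
           (∀ (j : Sig U) → ∃[ h ] HomOver u (sig j) h → j ≡ i))
    deg : ∀ {A B} → InD B → A ⇒ B → ℕ
    deg-pos : ∀ {A B} (dB : InD B) (f : A ⇒ B) → 1 ≤ deg dB f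
    G4-I : ∀ {A B E} (dB : InD B) (dE : InD E) (f : A ⇒ B) (g : B ⇒ E) →
           deg dE (g ∘ f) ≡ deg dE g * deg dB f
    G4-II : ∀ {U B} (dB : InD B) (f : U ⇒ B) →
            Σ[ n ∈ ℕ ] Σ[ e ∈ (Fin n ↔ Sig U) ]
              (deg dB f ≡ ∑ n (λ k → deg dB (f ∘ sig (Inverse.to e k))))
    G4-III : ∀ {A B C' U} (dA : InD A) (dB : InD B) (dC : InD C') →
             (f : B ⇒ A) (g : C' ⇒ A) (p : U ⇒ B) (q : U ⇒ C') →
             IsPullback f g p q → (deg dA f ≡ deg dC q × deg dA g ≡ deg dB p)

  record Cover (X : Obj) : Set (o ⊔ ℓ) where
    constructor cover
    field
      src    : Obj
      srcInD : InD src
      tgtInD : InD X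
      arr    : src ⇒ X
  open Cover public

  degC : ∀ {X} → Cover X → ℕ
  degC f = deg (tgtInD f) (arr f)

  Hom : ∀ {X} (g f : Cover X) → src g ⇒ src f → Set ℓ
  Hom g f h = HomOver (arr g) (arr f) h

  Aut : ∀ {X} (f : Cover X) → src f ⇒ src f → Set ℓ
  Aut f h = Hom f f h × IsIso h

  IsGalois : ∀ {X} → Cover X → Set ℓ
  IsGalois f = HasCard (Aut f) (degC f)

  _⊑_ : ∀ {X} → Cover X → Cover X → Set ℓ
  f ⊑ g = ∃[ h ] Hom g f h

  Minimal : ∀ {p X} → (Cover X → Set p) → Cover X → Set (o ⊔ ℓ ⊔ p)
  Minimal P g = P g × (∀ h → P h → h ⊑ g → g ⊑ h)

  GaloisClosure : ∀ {X} (f g : Cover X) → Set (o ⊔ ℓ)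
  GaloisClosure f g = Minimal (λ h → IsGalois h × f ⊑ h) g

{-# OPTIONS --safe #-}
-- Pull f back along g. Elements of Hom(g,f) correspond to sections of the projection onto the
-- source of g; distinct sections lie in distinct components of the pullback, and those components
-- have degree 1 over g. Hence |Hom(g,f)| = deg f exactly when every component is the graph of an
-- element of Hom(g,f), and then every square over X from g to f factors through Hom(g,f).
-- If g is minimal with this property, glue two copies of g along a component of g ×_X g: the
-- pushout still has deg f maps to f, so minimality maps it back to g, which exhibits the component
-- as the graph of an automorphism of g; so g is Galois. A Galois h with f ⊑ h has deg f maps to f,
-- so minimality of g with respect to that property gives minimality among Galois covers above f.
module Submission where

open import Defs
open import Level using (Level; _⊔_)
open import Data.Nat using (ℕ; zero; suc; _+_; _*_; _≤_; z≤n; s≤s; >-nonZero)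
open import Data.Nat.Properties using (+-mono-≤; ≤-trans; ≤-reflexive; *-cancelˡ-≡; *-identityʳ; m*n≡1⇒m≡1)
open import Data.Fin using (Fin; zero; suc; punchOut)
open import Data.Fin.Properties using (any?; punchOut-injective; <⇒notInjective) renaming (_≟_ to _≟ᶠ_)
open import Data.Product using (Σ-syntax; ∃-syntax; _×_; _,_; proj₁; proj₂)
open import Function.Bundles using (_↔_; Inverse; Injection)
open import Function.Definitions using (Injective)
open import Function.Properties.Inverse using (↔⇒↣; ↔-sym)
open import Relation.Nullary using (yes; no)
open import Data.Empty using (⊥-elim)
open import Relation.Binary.PropositionalEquality

∑-ones : ∀ n (d : Fin n → ℕ) → (∀ k → d k ≡ 1) → ∑ n d ≡ n
∑-ones zero    d d≡1 = refl
∑-ones (suc n) d d≡1 = cong₂ _+_ (d≡1 zero) (∑-ones n (λ k → d (suc k)) (λ k → d≡1 (suc k)))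

n≤∑ : ∀ n (d : Fin n → ℕ) → (∀ k → 1 ≤ d k) → n ≤ ∑ n d
n≤∑ zero    d 1≤d = z≤n
n≤∑ (suc n) d 1≤d = +-mono-≤ (1≤d zero) (n≤∑ n (λ k → d (suc k)) (λ k → 1≤d (suc k)))

∑-pos⇒Fin : ∀ n (d : Fin n → ℕ) → 1 ≤ ∑ n d → Fin n
∑-pos⇒Fin (suc n) d _ = zero

Fin-irrelevant : ∀ {n} → n ≤ 1 → (i j : Fin n) → i ≡ j
Fin-irrelevant {suc zero}    _        zero zero = refl
Fin-irrelevant {suc (suc n)} (s≤s ()) _    _

injective⇒surjective : ∀ {m n} {F : Fin m → Fin n} → Injective _≡_ _≡_ F → n ≤ m →
                       ∀ k → ∃[ j ] F j ≡ k
injective⇒surjective {F = F} F-injective n≤m k with any? (λ j → F j ≟ᶠ k)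
... | yes hit = hit
injective⇒surjective {n = suc n} {F} F-injective n≤m k | no miss =
  ⊥-elim (<⇒notInjective n≤m avoid-injective)
  where
  k≢F : ∀ j → k ≢ F j
  k≢F j k≡Fj = miss (j , sym k≡Fj)

  avoid : Fin _ → Fin n
  avoid j = punchOut (k≢F j)

  avoid-injective : Injective _≡_ _≡_ avoid
  avoid-injective {x} {y} eq = F-injective (punchOut-injective (k≢F x) (k≢F y) eq)

HasCard-resp : ∀ {a p q} {X : Set a} {P : X → Set p} {Q : X → Set q} {n} →
               (∀ {x} → P x → Q x) → (∀ {x} → Q x → P x) → HasCard P n → HasCard Q n
HasCard-resp P⇒Q Q⇒P (e , e∈P , e-injective , e-onto) =
  e , (λ k → P⇒Q (e∈P k)) , e-injective , λ x x∈Q → e-onto x (Q⇒P x∈Q)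

module CategoryProperties {o ℓ} (𝐂 : Category o ℓ) where
  open Category 𝐂
  open CatDefs 𝐂
  open ≡-Reasoning

  module _ {A B C D : Obj} where
    pullʳ : ∀ {f : C ⇒ D} {a : B ⇒ C} {b : A ⇒ B} {c : A ⇒ C} → a ∘ b ≡ c → (f ∘ a) ∘ b ≡ f ∘ c
    pullʳ {f} {a} {b} eq = trans (assoc b a f) (cong (f ∘_) eq)

    pullˡ : ∀ {f : A ⇒ B} {a : C ⇒ D} {b : B ⇒ C} {c : B ⇒ D} → a ∘ b ≡ c → a ∘ (b ∘ f) ≡ c ∘ f
    pullˡ {f} {a} {b} eq = trans (sym (assoc f b a)) (cong (_∘ f) eq)

    extendˡ : ∀ {E} {f : A ⇒ B} {a : C ⇒ D} {b : B ⇒ C} {c : E ⇒ D} {d : B ⇒ E} →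
              a ∘ b ≡ c ∘ d → a ∘ (b ∘ f) ≡ c ∘ (d ∘ f)
    extendˡ {f = f} {c = c} {d} eq = trans (pullˡ eq) (assoc f d c)

    extendʳ : ∀ {E} {f : C ⇒ D} {a : B ⇒ C} {b : A ⇒ B} {c : E ⇒ C} {d : A ⇒ E} →
              a ∘ b ≡ c ∘ d → (f ∘ a) ∘ b ≡ (f ∘ c) ∘ d
    extendʳ {f = f} {c = c} {d} eq = trans (pullʳ eq) (sym (assoc d c f))

  HomOver-∘ : ∀ {A B C X} {f : A ⇒ X} {g : B ⇒ X} {h : C ⇒ X} {a : B ⇒ C} {b : C ⇒ A} →
              HomOver g h a → HomOver h f b → HomOver g f (b ∘ a)
  HomOver-∘ {f = f} {a = a} {b} ga hb = trans ga (trans (cong (_∘ a) hb) (assoc a b f))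

  HomOver-inverse : ∀ {A B X} {f : A ⇒ X} {g : B ⇒ X} {a : B ⇒ A} {a' : A ⇒ B} →
                    HomOver g f a → a ∘ a' ≡ id → HomOver f g a'
  HomOver-inverse {f = f} {g} {a} {a'} ga a∘a'≡id = sym (begin
    g ∘ a'          ≡⟨ cong (_∘ a') ga ⟩
    (f ∘ a) ∘ a'    ≡⟨ pullʳ a∘a'≡id ⟩
    f ∘ id          ≡⟨ identityʳ f ⟩
    f               ∎)

module _ {o ℓ s : Level} (S : Setting o ℓ s) where
  open Setting S
  open Category 𝐂
  open CatDefs 𝐂
  open CategoryProperties 𝐂
  open ≡-Reasoning

  record Pullback {A B C} (f : B ⇒ A) (g : C ⇒ A) : Set (o ⊔ ℓ) where
    field
      apex       : Obj
      π₁         : apex ⇒ B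
      π₂         : apex ⇒ C
      isPullback : IsPullback f g π₁ π₂

    commute : f ∘ π₁ ≡ g ∘ π₂
    commute = proj₁ isPullback

    module _ {V} {a : V ⇒ B} {b : V ⇒ C} (eq : f ∘ a ≡ g ∘ b) where
      mediate : V ⇒ apex
      mediate = proj₁ (proj₂ isPullback a b eq)

      π₁∘mediate : π₁ ∘ mediate ≡ a
      π₁∘mediate = proj₁ (proj₁ (proj₂ (proj₂ isPullback a b eq)))

      π₂∘mediate : π₂ ∘ mediate ≡ b
      π₂∘mediate = proj₂ (proj₁ (proj₂ (proj₂ isPullback a b eq)))

      mediate-unique : ∀ u → π₁ ∘ u ≡ a → π₂ ∘ u ≡ b → u ≡ mediate
      mediate-unique = proj₂ (proj₂ (proj₂ isPullback a b eq))

    jointly-monic : ∀ {V} {u v : V ⇒ apex} → π₁ ∘ u ≡ π₁ ∘ v → π₂ ∘ u ≡ π₂ ∘ v → u ≡ v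
    jointly-monic {u = u} {v} eq₁ eq₂ =
      trans (mediate-unique (extendˡ commute) u refl refl)
            (sym (mediate-unique (extendˡ commute) v (sym eq₁) (sym eq₂)))

  pullback : ∀ {A B C} → InD A → InD B → InD C → (f : B ⇒ A) (g : C ⇒ A) → Pullback f g
  pullback dA dB dC f g with G1 dA dB dC f g
  ... | P , p , q , isPullback = record { apex = P ; π₁ = p ; π₂ = q ; isPullback = isPullback }

  record PushoutInD {A B C} (f : A ⇒ B) (g : A ⇒ C) : Set (o ⊔ ℓ) where
    field
      apex      : Obj
      apexInD   : InD apex
      ι₁        : B ⇒ apex
      ι₂        : C ⇒ apex
      isPushout : IsPushoutInD f g ι₁ ι₂

    commute : ι₁ ∘ f ≡ ι₂ ∘ g
    commute = proj₁ isPushout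

    module _ {Q} (dQ : InD Q) {a : B ⇒ Q} {b : C ⇒ Q} (eq : a ∘ f ≡ b ∘ g) where
      copair : apex ⇒ Q
      copair = proj₁ (proj₂ isPushout dQ a b eq)

      copair∘ι₁ : copair ∘ ι₁ ≡ a
      copair∘ι₁ = proj₁ (proj₁ (proj₂ (proj₂ isPushout dQ a b eq)))

      copair∘ι₂ : copair ∘ ι₂ ≡ b
      copair∘ι₂ = proj₂ (proj₁ (proj₂ (proj₂ isPushout dQ a b eq)))

      copair-unique : ∀ u → u ∘ ι₁ ≡ a → u ∘ ι₂ ≡ b → u ≡ copair
      copair-unique = proj₂ (proj₂ (proj₂ isPushout dQ a b eq))

  pushoutInD : ∀ {A B C} → InD A → InD B → InD C → (f : A ⇒ B) (g : A ⇒ C) → PushoutInD f g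
  pushoutInD dA dB dC f g with G2-I dA dB dC f g
  ... | Z , dZ , ι₁ , ι₂ , isPushout =
    record { apex = Z ; apexInD = dZ ; ι₁ = ι₁ ; ι₂ = ι₂ ; isPushout = isPushout }

  module _ {U A} (dA : InD A) (u : A ⇒ U) where
    component : Sig U
    component = proj₁ (G3 dA u)

    component-factor : ∃[ h ] u ≡ sig component ∘ h
    component-factor = proj₁ (proj₂ (G3 dA u))

    component-unique : ∀ j → ∃[ h ] u ≡ sig j ∘ h → j ≡ component
    component-unique = proj₂ (proj₂ (G3 dA u))

  sig-factor⇒≡ : ∀ {U} {i j : Sig U} {h} → sig i ≡ sig j ∘ h → j ≡ i
  sig-factor⇒≡ {i = i} {j} {h} eq =
    trans (component-unique (sigInD i) (sig i) j (h , eq))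
          (sym (component-unique (sigInD i) (sig i) i (id , sym (identityʳ (sig i)))))

  someComponent : ∀ {U B} → InD B → U ⇒ B → Sig U
  someComponent dB f with G4-II dB f
  ... | n , e , deg≡∑ = Inverse.to e (∑-pos⇒Fin n _ (subst (1 ≤_) deg≡∑ (deg-pos dB f)))

  cospan-square : ∀ {A B C} → InD A → InD B → InD C → (f : B ⇒ A) (g : C ⇒ A) →
                  Σ[ D ∈ Obj ] (InD D × Σ[ α ∈ D ⇒ B ] Σ[ β ∈ D ⇒ C ] f ∘ α ≡ g ∘ β)
  cospan-square dA dB dC f g =
    sigDom i , sigInD i , π₁ ∘ sig i , π₂ ∘ sig i , extendˡ commute
    where
    open Pullback (pullback dA dB dC f g)

    i : Sig apex
    i = someComponent dB π₁

  deg-cancelʳ : ∀ {A B E} (dB : InD B) (dE : InD E) (r : A ⇒ B) (g : B ⇒ E) →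
                deg dE (g ∘ r) ≡ deg dE g → deg dB r ≡ 1
  deg-cancelʳ dB dE r g eq = *-cancelˡ-≡ (deg dB r) 1 (deg dE g) {{>-nonZero (deg-pos dE g)}} (begin
    deg dE g * deg dB r ≡⟨ sym (G4-I dB dE r g) ⟩
    deg dE (g ∘ r)      ≡⟨ eq ⟩
    deg dE g            ≡⟨ sym (*-identityʳ (deg dE g)) ⟩
    deg dE g * 1        ∎)

  deg-id : ∀ {B} (dB : InD B) → deg dB (id {B}) ≡ 1
  deg-id dB = deg-cancelʳ dB dB id id (cong (deg dB) (identityˡ id))

  hasSection⇒deg≡1 : ∀ {A B} (dA : InD A) (dB : InD B) (y : A ⇒ B) (t : B ⇒ A) → y ∘ t ≡ id → deg dB y ≡ 1
  hasSection⇒deg≡1 dA dB y t y∘t≡id =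
    m*n≡1⇒m≡1 (deg dB y) (deg dA t) (trans (sym (G4-I dA dB t y)) (trans (cong (deg dB) y∘t≡id) (deg-id dB)))

  module Sections {X} (f g : Cover X) where
    open Pullback (pullback (tgtInD f) (srcInD f) (srcInD g) (arr f) (arr g)) public
      renaming (apex to P; π₁ to p; π₂ to q)

    IsGraph : Sig P → src g ⇒ src f → Set ℓ
    IsGraph i ψ = p ∘ sig i ≡ ψ ∘ (q ∘ sig i)

    isGraph-unique : ∀ {i ψ ψ'} → IsGraph i ψ → IsGraph i ψ' → ψ ≡ ψ'
    isGraph-unique {i} graph graph' =
      G2-II (sigInD i) (srcInD g) (q ∘ sig i) (srcInD f) _ _ (trans (sym graph) graph')

    module _ {ψ} (hψ : Hom g f ψ) where
      section : src g ⇒ P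
      section = mediate (trans (sym hψ) (sym (identityʳ (arr g))))

      p∘section : p ∘ section ≡ ψ
      p∘section = π₁∘mediate _

      q∘section : q ∘ section ≡ id
      q∘section = π₂∘mediate _

      componentOf : Sig P
      componentOf = component (srcInD g) section

      private
        t : src g ⇒ sigDom componentOf
        t = proj₁ (component-factor (srcInD g) section)

        through-section : ∀ {Y} (r : P ⇒ Y) → (r ∘ sig componentOf) ∘ t ≡ r ∘ section
        through-section r = pullʳ (sym (proj₂ (component-factor (srcInD g) section)))

      componentOf-deg : deg (srcInD g) (q ∘ sig componentOf) ≡ 1
      componentOf-deg = hasSection⇒deg≡1 (sigInD componentOf) (srcInD g) _ t
        (trans (through-section q) q∘section)

      componentOf-isGraph : IsGraph componentOf ψ
      componentOf-isGraph = G2-II (srcInD g) (sigInD componentOf) t (srcInD f) _ _ (begin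
        (p ∘ sig componentOf) ∘ t         ≡⟨ trans (through-section p) p∘section ⟩
        ψ                                 ≡⟨ sym (identityʳ ψ) ⟩
        ψ ∘ id                            ≡⟨ cong (ψ ∘_) (sym (trans (through-section q) q∘section)) ⟩
        ψ ∘ ((q ∘ sig componentOf) ∘ t)   ≡⟨ sym (assoc t _ ψ) ⟩
        (ψ ∘ (q ∘ sig componentOf)) ∘ t   ∎)

      isGraph⇒componentOf : ∀ {i} → IsGraph i ψ → componentOf ≡ i
      isGraph⇒componentOf {i} graph = sig-factor⇒≡ (begin
        sig i                               ≡⟨ jointly-monic p-agrees q-agrees ⟩
        section ∘ (q ∘ sig i)               ≡⟨ cong (_∘ (q ∘ sig i)) (proj₂ (component-factor (srcInD g) section)) ⟩
        (sig componentOf ∘ t) ∘ (q ∘ sig i) ≡⟨ assoc _ t _ ⟩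
        sig componentOf ∘ (t ∘ (q ∘ sig i)) ∎)
        where
        p-agrees : p ∘ sig i ≡ p ∘ (section ∘ (q ∘ sig i))
        p-agrees = trans graph (sym (pullˡ p∘section))

        q-agrees : q ∘ sig i ≡ q ∘ (section ∘ (q ∘ sig i))
        q-agrees = sym (trans (pullˡ q∘section) (identityˡ _))

    componentCount : ℕ
    componentCount = proj₁ (G4-II (srcInD g) q)

    enumerate : Fin componentCount ↔ Sig P
    enumerate = proj₁ (proj₂ (G4-II (srcInD g) q))

    open Inverse enumerate using (to; from; strictlyInverseˡ)

    to-injective : Injective _≡_ _≡_ to
    to-injective = Injection.injective (↔⇒↣ enumerate)

    from-injective : Injective _≡_ _≡_ from
    from-injective = Injection.injective (↔⇒↣ (↔-sym enumerate))

    degC≡∑ : degC f ≡ ∑ componentCount (λ k → deg (srcInD g) (q ∘ sig (to k)))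
    degC≡∑ = trans (proj₁ (G4-III (tgtInD f) (srcInD f) (srcInD g) (arr f) (arr g) p q isPullback))
                   (proj₂ (proj₂ (G4-II (srcInD g) q)))

    componentCount≤degC : componentCount ≤ degC f
    componentCount≤degC = subst (componentCount ≤_) (sym degC≡∑) (n≤∑ _ _ (λ k → deg-pos (srcInD g) _))

    -- f becomes trivial after pulling back along g.
    Splits : Set (s ⊔ ℓ)
    Splits = ∀ i → Σ[ ψ ∈ src g ⇒ src f ] (Hom g f ψ × IsGraph i ψ)

    splits⇒hasCard : Splits → HasCard (Hom g f) (degC f)
    splits⇒hasCard splits = subst (HasCard (Hom g f)) count≡degC (graph , graph∈Hom , graph-injective , graph-onto)
      where
      graph : Fin componentCount → src g ⇒ src f
      graph k = proj₁ (splits (to k))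

      graph∈Hom : ∀ k → Hom g f (graph k)
      graph∈Hom k = proj₁ (proj₂ (splits (to k)))

      graph-isGraph : ∀ k → IsGraph (to k) (graph k)
      graph-isGraph k = proj₂ (proj₂ (splits (to k)))

      count≡degC : componentCount ≡ degC f
      count≡degC = sym (trans degC≡∑ (∑-ones _ _ λ k →
        subst (λ i → deg (srcInD g) (q ∘ sig i) ≡ 1)
              (isGraph⇒componentOf (graph∈Hom k) (graph-isGraph k)) (componentOf-deg (graph∈Hom k))))

      graph-injective : ∀ k l → graph k ≡ graph l → k ≡ l
      graph-injective k l eq = to-injective (begin
        to k                        ≡⟨ sym (isGraph⇒componentOf (graph∈Hom k) (graph-isGraph k)) ⟩
        componentOf (graph∈Hom k)   ≡⟨ isGraph⇒componentOf (graph∈Hom k)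
                                         (subst (IsGraph (to l)) (sym eq) (graph-isGraph l)) ⟩
        to l                        ∎)

      graph-onto : ∀ ψ → Hom g f ψ → ∃[ k ] graph k ≡ ψ
      graph-onto ψ hψ = k , isGraph-unique
        (subst (λ i → IsGraph i (graph k)) (strictlyInverseˡ (componentOf hψ)) (graph-isGraph k))
        (componentOf-isGraph hψ)
        where
        k : Fin componentCount
        k = from (componentOf hψ)

    hasCard⇒splits : HasCard (Hom g f) (degC f) → Splits
    hasCard⇒splits (en , en∈Hom , en-injective , _) i =
      en j , en∈Hom j , subst (λ c → IsGraph c (en j)) (from-injective Fj≡i) (componentOf-isGraph (en∈Hom j))
      where
      F : Fin (degC f) → Fin componentCount
      F k = from (componentOf (en∈Hom k))

      F-injective : Injective _≡_ _≡_ F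
      F-injective {k} {l} eq = en-injective k l (isGraph-unique
        (componentOf-isGraph (en∈Hom k))
        (subst (λ c → IsGraph c (en l)) (sym (from-injective eq)) (componentOf-isGraph (en∈Hom l))))

      hit : ∃[ j ] F j ≡ from i
      hit = injective⇒surjective F-injective componentCount≤degC (from i)

      j : Fin (degC f)
      j = proj₁ hit

      Fj≡i : F j ≡ from i
      Fj≡i = proj₂ hit

    splits⇒lift : Splits → ∀ {E} → InD E → (u : E ⇒ src g) (φ : E ⇒ src f) → arr f ∘ φ ≡ arr g ∘ u →
                  Σ[ ψ ∈ src g ⇒ src f ] (Hom g f ψ × φ ≡ ψ ∘ u)
    splits⇒lift splits {E} dE u φ eq = ψ , hψ , (begin
      φ                          ≡⟨ sym (π₁∘mediate eq) ⟩
      p ∘ w                      ≡⟨ cong (p ∘_) w≡ ⟩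
      p ∘ (sig c ∘ m)            ≡⟨ sym (assoc m (sig c) p) ⟩
      (p ∘ sig c) ∘ m            ≡⟨ cong (_∘ m) graph ⟩
      (ψ ∘ (q ∘ sig c)) ∘ m      ≡⟨ pullʳ (pullʳ (sym w≡)) ⟩
      ψ ∘ (q ∘ w)                ≡⟨ cong (ψ ∘_) (π₂∘mediate eq) ⟩
      ψ ∘ u                      ∎)
      where
      w : E ⇒ P
      w = mediate eq

      c : Sig P
      c = component dE w

      m : E ⇒ sigDom c
      m = proj₁ (component-factor dE w)

      w≡ : w ≡ sig c ∘ m
      w≡ = proj₂ (component-factor dE w)

      ψ : src g ⇒ src f
      ψ = proj₁ (splits c)

      hψ : Hom g f ψ
      hψ = proj₁ (proj₂ (splits c))

      graph : IsGraph c ψ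
      graph = proj₂ (proj₂ (splits c))

  deg≡1⇒isIso : ∀ {A B} (dA : InD A) (dB : InD B) (r : A ⇒ B) → deg dB r ≡ 1 → IsIso r
  deg≡1⇒isIso {A} dA dB r deg≡1 = G2-III dA dB r r-monic
    where
    -- r ×_B r has a single component, the one containing the diagonal, on which both projections agree.
    open Sections (cover A dA dB r) (cover A dA dB r)

    components-equal : ∀ (i j : Sig P) → i ≡ j
    components-equal i j = from-injective
      (Fin-irrelevant (≤-trans componentCount≤degC (≤-reflexive deg≡1)) (from i) (from j))
      where open Inverse enumerate using (from)

    projections-agree : ∀ j → p ∘ sig j ≡ q ∘ sig j
    projections-agree j = subst (λ i → p ∘ sig i ≡ q ∘ sig i)
      (components-equal (componentOf diagonal) j)
      (trans (componentOf-isGraph diagonal) (identityˡ _))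
      where
      diagonal : Hom (cover A dA dB r) (cover A dA dB r) id
      diagonal = sym (identityʳ r)

    r-monic : MonicInD r
    r-monic {Q} dQ a b ra≡rb = begin
      a                ≡⟨ sym (π₁∘mediate ra≡rb) ⟩
      p ∘ w            ≡⟨ cong (p ∘_) w≡ ⟩
      p ∘ (sig j ∘ m)  ≡⟨ extendˡ (projections-agree j) ⟩
      q ∘ (sig j ∘ m)  ≡⟨ cong (q ∘_) (sym w≡) ⟩
      q ∘ w            ≡⟨ π₂∘mediate ra≡rb ⟩
      b                ∎
      where
      w : Q ⇒ P
      w = mediate ra≡rb

      j : Sig P
      j = component dQ w

      m : Q ⇒ sigDom j
      m = proj₁ (component-factor dQ w)

      w≡ : w ≡ sig j ∘ m
      w≡ = proj₂ (component-factor dQ w)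

  Hom⇒isIso : ∀ {X} (g : Cover X) {r} → Hom g g r → IsIso r
  Hom⇒isIso g {r} hr = deg≡1⇒isIso (srcInD g) (srcInD g) r
    (deg-cancelʳ (srcInD g) (tgtInD g) r (arr g) (sym (cong (deg (tgtInD g)) hr)))

  isGalois⇒hasCard : ∀ {X} (g : Cover X) → IsGalois g → HasCard (Hom g g) (degC g)
  isGalois⇒hasCard g = HasCard-resp proj₁ (λ hr → hr , Hom⇒isIso g hr)

  hasCard⇒isGalois : ∀ {X} (g : Cover X) → HasCard (Hom g g) (degC g) → IsGalois g
  hasCard⇒isGalois g = HasCard-resp (λ hr → hr , Hom⇒isIso g hr) proj₁

  module PushoutCover {X} (g : Cover X) {C} (dC : InD C) {a b : C ⇒ src g} (ga≡gb : arr g ∘ a ≡ arr g ∘ b) where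
    open PushoutInD (pushoutInD dC (srcInD g) (srcInD g) a b) public

    pushoutCover : Cover X
    pushoutCover = cover apex apexInD (tgtInD g) (copair (tgtInD g) ga≡gb)

    ι₁∈Hom : Hom g pushoutCover ι₁
    ι₁∈Hom = sym (copair∘ι₁ (tgtInD g) ga≡gb)

    ι₂∈Hom : Hom g pushoutCover ι₂
    ι₂∈Hom = sym (copair∘ι₂ (tgtInD g) ga≡gb)

    pushoutCover-hasCard : ∀ f → HasCard (Hom g f) (degC f) → HasCard (Hom pushoutCover f) (degC f)
    pushoutCover-hasCard f hasCard@(en , en∈Hom , en-injective , en-onto) =
      glued , glued∈Hom , glued-injective , glued-onto
      where
      open Sections f g using (hasCard⇒splits; splits⇒lift)

      lift : ∀ k → Σ[ ψ ∈ src g ⇒ src f ] (Hom g f ψ × en k ∘ a ≡ ψ ∘ b)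
      lift k = splits⇒lift (hasCard⇒splits hasCard) dC b (en k ∘ a)
        (trans (pullˡ (sym (en∈Hom k))) ga≡gb)

      partner : Fin (degC f) → src g ⇒ src f
      partner k = proj₁ (lift k)

      en∘a≡partner∘b : ∀ k → en k ∘ a ≡ partner k ∘ b
      en∘a≡partner∘b k = proj₂ (proj₂ (lift k))

      glued : Fin (degC f) → apex ⇒ src f
      glued k = copair (srcInD f) (en∘a≡partner∘b k)

      glued∘ι₁ : ∀ k → glued k ∘ ι₁ ≡ en k
      glued∘ι₁ k = copair∘ι₁ (srcInD f) (en∘a≡partner∘b k)

      glued∈Hom : ∀ k → Hom pushoutCover f (glued k)
      glued∈Hom k = G2-II (srcInD g) apexInD ι₁ (tgtInD g) _ _ (begin
        arr pushoutCover ∘ ι₁   ≡⟨ sym ι₁∈Hom ⟩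
        arr g                   ≡⟨ en∈Hom k ⟩
        arr f ∘ en k            ≡⟨ cong (arr f ∘_) (sym (glued∘ι₁ k)) ⟩
        arr f ∘ (glued k ∘ ι₁)  ≡⟨ sym (assoc ι₁ (glued k) (arr f)) ⟩
        (arr f ∘ glued k) ∘ ι₁  ∎)

      glued-injective : ∀ k l → glued k ≡ glued l → k ≡ l
      glued-injective k l eq =
        en-injective k l (trans (sym (glued∘ι₁ k)) (trans (cong (_∘ ι₁) eq) (glued∘ι₁ l)))

      glued-onto : ∀ x → Hom pushoutCover f x → ∃[ k ] glued k ≡ x
      glued-onto x hx = k , sym (copair-unique (srcInD f) (en∘a≡partner∘b k) x (sym en-k≡) x∘ι₂≡)
        where
        x∘ι₁∈Hom : Hom g f (x ∘ ι₁)
        x∘ι₁∈Hom = HomOver-∘ ι₁∈Hom hx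

        k : Fin (degC f)
        k = proj₁ (en-onto (x ∘ ι₁) x∘ι₁∈Hom)

        en-k≡ : en k ≡ x ∘ ι₁
        en-k≡ = proj₂ (en-onto (x ∘ ι₁) x∘ι₁∈Hom)

        x∘ι₂≡ : x ∘ ι₂ ≡ partner k
        x∘ι₂≡ = G2-II dC (srcInD g) b (srcInD f) _ _ (begin
          (x ∘ ι₂) ∘ b   ≡⟨ extendʳ (sym commute) ⟩
          (x ∘ ι₁) ∘ a   ≡⟨ cong (_∘ a) (sym en-k≡) ⟩
          en k ∘ a       ≡⟨ en∘a≡partner∘b k ⟩
          partner k ∘ b  ∎)

  identified⇒graph : ∀ {X} (g : Cover X) → let open Sections g g in
                     ∀ {i e₁ e₂} → Hom g g e₁ → Hom g g e₂ → e₁ ∘ (p ∘ sig i) ≡ e₂ ∘ (q ∘ sig i) →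
                     Σ[ ψ ∈ src g ⇒ src g ] (Hom g g ψ × IsGraph i ψ)
  identified⇒graph g {i} {e₁} {e₂} e₁∈Hom e₂∈Hom e₁p≡e₂q with Hom⇒isIso g e₁∈Hom
  ... | e₁⁻¹ , e₁⁻¹∘e₁≡id , e₁∘e₁⁻¹≡id =
    e₁⁻¹ ∘ e₂ , HomOver-∘ e₂∈Hom (HomOver-inverse e₁∈Hom e₁∘e₁⁻¹≡id) , (begin
      p ∘ sig i                   ≡⟨ sym (identityˡ _) ⟩
      id ∘ (p ∘ sig i)            ≡⟨ cong (_∘ (p ∘ sig i)) (sym e₁⁻¹∘e₁≡id) ⟩
      (e₁⁻¹ ∘ e₁) ∘ (p ∘ sig i)   ≡⟨ pullʳ e₁p≡e₂q ⟩
      e₁⁻¹ ∘ (e₂ ∘ (q ∘ sig i))   ≡⟨ sym (assoc _ e₂ e₁⁻¹) ⟩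
      (e₁⁻¹ ∘ e₂) ∘ (q ∘ sig i)   ∎)
    where open Sections g g using (p; q)

  minimal⇒splits : ∀ {X} (f g : Cover X) → Minimal (λ h → HasCard (Hom h f) (degC f)) g → Sections.Splits g g
  minimal⇒splits f g (hasCard , minimal) i =
    identified⇒graph g (HomOver-∘ ι₁∈Hom y∈Hom) (HomOver-∘ ι₂∈Hom y∈Hom) (extendʳ commute)
    where
    open Sections g g using (p; q) renaming (commute to pullback-commute)
    open PushoutCover g (sigInD i) (extendˡ pullback-commute)

    g⊑pushoutCover : g ⊑ pushoutCover
    g⊑pushoutCover = minimal pushoutCover (pushoutCover-hasCard f hasCard) (ι₁ , ι₁∈Hom)

    y : apex ⇒ src g
    y = proj₁ g⊑pushoutCover

    y∈Hom : Hom pushoutCover g y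
    y∈Hom = proj₂ g⊑pushoutCover

  minimal⇒isGalois : ∀ {X} (f g : Cover X) → Minimal (λ h → HasCard (Hom h f) (degC f)) g → IsGalois g
  minimal⇒isGalois f g minimal =
    hasCard⇒isGalois g (Sections.splits⇒hasCard g g (minimal⇒splits f g minimal))

  ⊑-isGalois⇒hasCard : ∀ {X} (f h : Cover X) → IsGalois h → f ⊑ h → HasCard (Hom h f) (degC f)
  ⊑-isGalois⇒hasCard f h galois (ψ₀ , ψ₀∈Hom) = splits⇒hasCard splits
    where
    open Sections f h

    lift-along-h : ∀ {E} → InD E → (u φ : E ⇒ src h) → arr h ∘ φ ≡ arr h ∘ u →
                   Σ[ a ∈ src h ⇒ src h ] (Hom h h a × φ ≡ a ∘ u)
    lift-along-h = Sections.splits⇒lift h h (Sections.hasCard⇒splits h h (isGalois⇒hasCard h galois))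

    splits : Splits
    splits j with cospan-square (srcInD f) (srcInD h) (sigInD j) ψ₀ (p ∘ sig j)
    ... | D , dD , α , β , ψ₀α≡ = ψ₀ ∘ a , HomOver-∘ a∈Hom ψ₀∈Hom ,
      G2-II dD (sigInD j) β (srcInD f) _ _ (begin
        (p ∘ sig j) ∘ β                 ≡⟨ sym ψ₀α≡ ⟩
        ψ₀ ∘ α                          ≡⟨ cong (ψ₀ ∘_) α≡ ⟩
        ψ₀ ∘ (a ∘ ((q ∘ sig j) ∘ β))    ≡⟨ sym (assoc _ a ψ₀) ⟩
        (ψ₀ ∘ a) ∘ ((q ∘ sig j) ∘ β)    ≡⟨ sym (assoc β _ _) ⟩
        ((ψ₀ ∘ a) ∘ (q ∘ sig j)) ∘ β    ∎)
      where
      square-over-h : arr h ∘ α ≡ arr h ∘ ((q ∘ sig j) ∘ β)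
      square-over-h = begin
        arr h ∘ α                     ≡⟨ cong (_∘ α) ψ₀∈Hom ⟩
        (arr f ∘ ψ₀) ∘ α              ≡⟨ pullʳ ψ₀α≡ ⟩
        arr f ∘ ((p ∘ sig j) ∘ β)     ≡⟨ cong (arr f ∘_) (assoc β (sig j) p) ⟩
        arr f ∘ (p ∘ (sig j ∘ β))     ≡⟨ extendˡ commute ⟩
        arr h ∘ (q ∘ (sig j ∘ β))     ≡⟨ cong (arr h ∘_) (sym (assoc β (sig j) q)) ⟩
        arr h ∘ ((q ∘ sig j) ∘ β)     ∎

      lifted : Σ[ a ∈ src h ⇒ src h ] (Hom h h a × α ≡ a ∘ ((q ∘ sig j) ∘ β))
      lifted = lift-along-h dD ((q ∘ sig j) ∘ β) α square-over-h

      a : src h ⇒ src h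
      a = proj₁ lifted

      a∈Hom : Hom h h a
      a∈Hom = proj₁ (proj₂ lifted)

      α≡ : α ≡ a ∘ ((q ∘ sig j) ∘ β)
      α≡ = proj₂ (proj₂ lifted)

theorem3p18 : ∀ {o ℓ s : Level} (S : Setting o ℓ s) → let open Setting S in
    ∀ {X} (f g : Cover X) → f ⊑ g →
    Minimal (λ h → HasCard (Hom h f) (degC f)) g →
    GaloisClosure f g
theorem3p18 S f g f⊑g minimal =
  (minimal⇒isGalois S f g minimal , f⊑g) ,
  λ h (h-galois , f⊑h) h⊑g → proj₂ minimal h (⊑-isGalois⇒hasCard S f h h-galois f⊑h) h⊑g
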